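{- For $n\in\mathbb N$ with $n>1$, let $\mathrm{QUPARITY}_n=P_n.\phi_n$ be the QBF defined in the context, and let $\psi_n=(\bar x_1\lor x_2)\land\bar x_2\land\cdots\land\bar x_n$. Then the QBF $P_n.(\phi_n\land\psi_n)$ (with the same prefix and the clauses of $\psi_n$ added) has a Q-Res refutation with no more than $2n+1$ steps.
   Context: A QBF is $P.\phi$ with $\phi$ a CNF (a conjunction of clauses, each clause a set/disjunction of literals $x$ or $\bar x$) and $P=Q_1x_1\cdots Q_mx_m$ a quantifier prefix with $Q_i\in\{\forall,\exists\}$; the prefix orders variables by $x_i<_P x_j$ iff $i<j$. The Q-Res calculus on $P.\phi$ has the rules: (A) any clause of $\phi$ may be derived; (R) from derived clauses $C\lor x$ and $C'\lor\bar x$, with $x$ existentially quantified and $C\cup C'$ not a tautology, derive $C\lor C'$; (U) from a derived clause $C\lor l$ with $l$ a universal literal, $\bar l\notin C$, and every existential literal $k\in C$ satisfying $k<_P l$, derive $C$. A refutation is a sequence of applications of R and U deriving the empty clause; steps are counted as applications of R and U (axiom uses A are not counted). $\mathrm{QUPARITY}_n$ ($n>1$) has prefix $\exists x_1\dots x_n\forall a_1a_2\exists y_2\dots y_n$ and clauses: $A_2=(\bar x_1\lor\bar x_2\lor\bar y_2\lor a_1\lor a_2)$, $B_2=(\bar x_1\lor x_2\lor y_2\lor a_1\lor a_2)$, $C_2=(x_1\lor\bar x_2\lor y_2\lor a_1\lor a_2)$, $D_2=(x_1\lor x_2\lor\bar y_2\lor a_1\lor a_2)$; for $j=3,\dots,n$: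 $A_j=(\bar y_{j-1}\lor\bar x_j\lor\bar y_j\lor a_1\lor a_2)$, $B_j=(\bar y_{j-1}\lor x_j\lor y_j\lor a_1\lor a_2)$, $C_j=(y_{j-1}\lor\bar x_j\lor y_j\lor a_1\lor a_2)$, $D_j=(y_{j-1}\lor x_j\lor\bar y_j\lor a_1\lor a_2)$; $E_1=(a_1\lor a_2\lor y_n)$, $E_2=(\bar a_1\lor\bar a_2\lor\bar y_n)$; and for $i=2,\dots,n$, clauses $A'_i,B'_i,C'_i,D'_i$ obtained from $A_i,B_i,C_i,D_i$ by replacing $a_1\lor a_2$ with $\bar a_1\lor\bar a_2$. -}

module Defs where

open import Data.Nat as ℕ using (ℕ; zero; suc; _+_; _*_; _≡ᵇ_)
open import Data.Bool using (Bool; true; false; not; _∧_)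
open import Data.Fin using (Fin; toℕ) renaming (_<_ to _<ᶠ_)
open import Data.Fin.Subset as S using (Subset)
open import Data.Vec using (tabulate)
open import Data.List using (List; []; _∷_; _++_; map; upTo)
open import Data.List.Membership.Propositional using () renaming (_∈_ to _∈ˡ_)
open import Data.Product using (Σ; _×_; _,_; ∃)
open import Data.Sum using (_⊎_)
open import Relation.Binary.PropositionalEquality using (_≡_)
open import Relation.Nullary using (¬_)

-- Generic QBFs over variables Fin m; the prefix order is the order of Fin.

data Quant : Set where
  ∀q ∃q : Quant

record Clause (m : ℕ) : Set where
  constructor clause
  field
    pos : Subset m
    neg : Subset m
open Clause public

-- literal: variable with polarity (true = positive x, false = negated x̄)
Lit : ℕ → Set
Lit m = Fin m × Bool

□ : ∀ {m} → Clause m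
□ = clause S.⊥ S.⊥

_∨_ : ∀ {m} → Clause m → Clause m → Clause m
clause p n ∨ clause p' n' = clause (p S.∪ p') (n S.∪ n')
infixr 5 _∨_

⟦_⟧ : ∀ {m} → Lit m → Clause m
⟦ v , true ⟧ = clause S.⁅ v ⁆ S.⊥
⟦ v , false ⟧ = clause S.⊥ S.⁅ v ⁆

neg-lit : ∀ {m} → Lit m → Lit m
neg-lit (v , b) = v , not b

_∈ᶜ_ : ∀ {m} → Lit m → Clause m → Set
(v , true) ∈ᶜ C = v S.∈ pos C
(v , false) ∈ᶜ C = v S.∈ neg C

_─_ : ∀ {m} → Clause m → Lit m → Clause m
clause p n ─ (v , true) = clause (p S.∩ S.∁ S.⁅ v ⁆) n
clause p n ─ (v , false) = clause p (n S.∩ S.∁ S.⁅ v ⁆)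

Tautology : ∀ {m} → Clause m → Set
Tautology C = ∃ λ v → v S.∈ pos C × v S.∈ neg C

record QBF (m : ℕ) : Set where
  constructor _·_
  field
    prefix : Fin m → Quant
    matrix : List (Clause m)
open QBF public

record ResStep {m} (F : QBF m) (Γ : List (Clause m)) (R : Clause m) : Set where
  field
    D E : Clause m
    D∈Γ : D ∈ˡ Γ
    E∈Γ : E ∈ˡ Γ
    x : Fin m
    x-∃ : prefix F x ≡ ∃q
    x∈D : (x , true) ∈ᶜ D
    x̄∈E : (x , false) ∈ᶜ E
    result : R ≡ (D ─ (x , true)) ∨ (E ─ (x , false))
    nonTaut : ¬ Tautology R

record RedStep {m} (F : QBF m) (Γ : List (Clause m)) (R : Clause m) : Set where
  field
    D : Clause m
    D∈Γ : D ∈ˡ Γ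
    l : Lit m
    l-∀ : prefix F (Data.Product.proj₁ l) ≡ ∀q
    l∈D : l ∈ᶜ D
    result : R ≡ D ─ l
    l̄∉R : ¬ (neg-lit l ∈ᶜ R)
    ∃-before : ∀ (k : Lit m) → k ∈ᶜ R → prefix F (Data.Product.proj₁ k) ≡ ∃q →
               Data.Product.proj₁ k <ᶠ Data.Product.proj₁ l

-- Q-Res derivations as sequences of clauses (most recent first), indexed by
-- the number of R/U steps (axiom uses are not counted).
data Derivation {m} (F : QBF m) : List (Clause m) → ℕ → Set where
  []  : Derivation F [] 0
  ax  : ∀ {Γ k C} → Derivation F Γ k → C ∈ˡ matrix F → Derivation F (C ∷ Γ) k
  res : ∀ {Γ k C} → Derivation F Γ k → ResStep F Γ C → Derivation F (C ∷ Γ) (suc k)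
  red : ∀ {Γ k C} → Derivation F Γ k → RedStep F Γ C → Derivation F (C ∷ Γ) (suc k)

Refutation : ∀ {m} → QBF m → ℕ → Set
Refutation F k = ∃ λ Γ → Derivation F (□ ∷ Γ) k

-- QUPARITY_n. Variables are numbered (m = 2n+1):
--   x_i ↦ i-1 (i = 1..n),  a_1 ↦ n,  a_2 ↦ n+1,  y_j ↦ n+j (j = 2..n).

module QUParity (n : ℕ) where
  m : ℕ
  m = 2 * n + 1

  lit : ℕ → Bool → Clause m
  lit i true  = clause (tabulate λ j → toℕ j ≡ᵇ i) S.⊥
  lit i false = clause S.⊥ (tabulate λ j → toℕ j ≡ᵇ i)

  x y : ℕ → Bool → Clause m
  x i b = lit (i ℕ.∸ 1) b
  y j b = lit (n + j) b
  a : ℕ → Bool → Clause m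
  a k b = lit (n + k ℕ.∸ 1) b

  prefixQ : Fin m → Quant
  prefixQ v with toℕ v ≡ᵇ n | toℕ v ≡ᵇ suc n
  ... | false | false = ∃q
  ... | _     | _     = ∀q

  prev : ℕ → Bool → Clause m
  prev 2 b = x 1 b
  prev j b = y (j ℕ.∸ 1) b

  -- A_j, B_j, C_j, D_j with universal part u  (u = a1∨a2 or ā1∨ā2)
  block : Clause m → ℕ → List (Clause m)
  block u j =
      (prev j false ∨ x j false ∨ y j false ∨ u)
    ∷ (prev j false ∨ x j true  ∨ y j true  ∨ u)
    ∷ (prev j true  ∨ x j false ∨ y j true  ∨ u)
    ∷ (prev j true  ∨ x j true  ∨ y j false ∨ u)
    ∷ []

  aa āā : Clause m
  aa = a 1 true ∨ a 2 true
  āā = a 1 false ∨ a 2 false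

  js : List ℕ
  js = map (λ i → i + 2) (upTo (n ℕ.∸ 1))

  concatMap' : (ℕ → List (Clause m)) → List ℕ → List (Clause m)
  concatMap' f [] = []
  concatMap' f (j ∷ l) = f j ++ concatMap' f l

  φ : List (Clause m)
  φ = concatMap' (block aa) js
      ++ (aa ∨ y n true)
      ∷ (āā ∨ y n false)
      ∷ concatMap' (block āā) js

  ψ : List (Clause m)
  ψ = (x 1 false ∨ x 2 true) ∷ map (λ j → x j false) js

  QUPARITY : QBF m
  QUPARITY = prefixQ · φ

  QUPARITY+ψ : QBF m
  QUPARITY+ψ = prefixQ · (φ ++ ψ)

-- Resolving D₂ = x₁ ∨ x₂ ∨ ȳ₂ ∨ a₁ ∨ a₂ with x̄₁ ∨ x₂ and then with the unit x̄₂
-- gives ȳ₂ ∨ a₁ ∨ a₂. From ȳ_{j-1} ∨ a₁ ∨ a₂, resolving with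
-- D_j = y_{j-1} ∨ x_j ∨ ȳ_j ∨ a₁ ∨ a₂ and then with x̄_j gives ȳ_j ∨ a₁ ∨ a₂, so
-- two steps per j reach ȳ_n ∨ a₁ ∨ a₂. One resolution with E₁ = a₁ ∨ a₂ ∨ y_n
-- leaves the purely universal clause a₁ ∨ a₂, and two universal reductions empty
-- it: 2(n − 1) + 3 = 2n + 1 steps. In each resolution the rest of one premise is
-- contained in the rest of the other, so every resolvent is again one of the
-- short clauses ȳ_j ∨ a₁ ∨ a₂, x_j ∨ ȳ_j ∨ a₁ ∨ a₂, a₁ ∨ a₂, none a tautology.

module Submission where

open import Defs
open import Data.Nat using (ℕ; _<_; _≤_; _+_; _*_)
open import Data.Product using (∃; _×_)

open import Data.Nat using (zero; suc; _∸_; _≡ᵇ_; z≤n; s≤s)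
open import Data.Nat.Properties
open import Data.Nat.Tactic.RingSolver using (solve-∀)
open import Data.Nat.DivMod using (_mod_; m<n⇒m%n≡m)
open import Data.Bool using (Bool; true; false; T)
open import Data.Bool.Properties using (T-≡)
open import Data.Fin using (Fin; toℕ)
open import Data.Fin.Properties using (toℕ-fromℕ<; toℕ-injective)
import Data.Fin.Subset as S
import Data.Fin.Subset.Properties as SP
open import Data.Vec using (tabulate)
open import Data.Vec.Properties using ([]=⇒lookup; lookup⇒[]=; lookup∘tabulate)
open import Data.List using (List; []; _∷_)
open import Data.List.Membership.Propositional using () renaming (_∈_ to _∈ˡ_)
open import Data.List.Membership.Propositional.Properties using (∈-map⁺; ∈-++⁺ˡ; ∈-++⁺ʳ; ∈-upTo⁺)
open import Data.List.Relation.Unary.Any using (here; there)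
open import Data.Product using (_,_; proj₁; proj₂)
open import Data.Sum using (_⊎_; inj₁; inj₂; [_,_]′)
open import Data.Empty using (⊥-elim)
open import Function using (_∘_; id; Equivalence)
open import Relation.Binary.PropositionalEquality hiding ([_])
open import Relation.Nullary using (¬_)

module _ {m : ℕ} where

  -- A record rather than ¬ (l ∈ᶜ C): _∈ᶜ_ computes on the polarity of l, and
  -- the record keeps l and C inferable by unification.
  record _∉ᶜ_ (l : Lit m) (C : Clause m) : Set where
    constructor mk∉ᶜ
    field ∉ᶜ-elim : ¬ (l ∈ᶜ C)
  open _∉ᶜ_ public

  _⊆ᶜ_ : Clause m → Clause m → Set
  C ⊆ᶜ C' = ∀ {l} → l ∈ᶜ C → l ∈ᶜ C'

  lit-≢ᵛ : ∀ {v w : Fin m} {b b' : Bool} → v ≢ w → _≢_ {A = Lit m} (v , b) (w , b')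
  lit-≢ᵛ v≢w = v≢w ∘ cong proj₁

  lit-≢ᵖ : ∀ {v w : Fin m} {b b' : Bool} → b ≢ b' → _≢_ {A = Lit m} (v , b) (w , b')
  lit-≢ᵖ b≢b' = b≢b' ∘ cong proj₂

  ∈ᶜ-∨⁻ : ∀ {l : Lit m} C C' → l ∈ᶜ (C ∨ C') → l ∈ᶜ C ⊎ l ∈ᶜ C'
  ∈ᶜ-∨⁻ {_ , true}  C C' = SP.x∈p∪q⁻ (pos C) (pos C')
  ∈ᶜ-∨⁻ {_ , false} C C' = SP.x∈p∪q⁻ (neg C) (neg C')

  ∈ᶜ-∨⁺ˡ : ∀ {l : Lit m} {C C'} → l ∈ᶜ C → l ∈ᶜ (C ∨ C')
  ∈ᶜ-∨⁺ˡ {_ , true}  = SP.x∈p∪q⁺ ∘ inj₁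
  ∈ᶜ-∨⁺ˡ {_ , false} = SP.x∈p∪q⁺ ∘ inj₁

  ∈ᶜ-∨⁺ʳ : ∀ {l : Lit m} {C C'} → l ∈ᶜ C' → l ∈ᶜ (C ∨ C')
  ∈ᶜ-∨⁺ʳ {_ , true}  = SP.x∈p∪q⁺ ∘ inj₂
  ∈ᶜ-∨⁺ʳ {_ , false} = SP.x∈p∪q⁺ ∘ inj₂

  ∉ᶜ-∨ : ∀ {l : Lit m} {C C'} → l ∉ᶜ C → l ∉ᶜ C' → l ∉ᶜ (C ∨ C')
  ∉ᶜ-∨ {C = C} {C'} (mk∉ᶜ l∉C) (mk∉ᶜ l∉C') = mk∉ᶜ ([ l∉C , l∉C' ]′ ∘ ∈ᶜ-∨⁻ C C')

  ∉ᶜ-□ : ∀ {l : Lit m} → l ∉ᶜ □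
  ∉ᶜ-□ {_ , true}  = mk∉ᶜ SP.∉⊥
  ∉ᶜ-□ {_ , false} = mk∉ᶜ SP.∉⊥

  ∈ᶜ-⟦⟧ : ∀ (l : Lit m) → l ∈ᶜ ⟦ l ⟧
  ∈ᶜ-⟦⟧ (v , true)  = SP.x∈⁅x⁆ v
  ∈ᶜ-⟦⟧ (v , false) = SP.x∈⁅x⁆ v

  ∈ᶜ-⟦⟧⁻ : ∀ {l : Lit m} l' → l ∈ᶜ ⟦ l' ⟧ → l ≡ l'
  ∈ᶜ-⟦⟧⁻ {_ , true}  (w , true)  = cong (_, true) ∘ SP.x∈⁅y⁆⇒x≡y w
  ∈ᶜ-⟦⟧⁻ {_ , true}  (w , false) = ⊥-elim ∘ SP.∉⊥
  ∈ᶜ-⟦⟧⁻ {_ , false} (w , true)  = ⊥-elim ∘ SP.∉⊥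
  ∈ᶜ-⟦⟧⁻ {_ , false} (w , false) = cong (_, false) ∘ SP.x∈⁅y⁆⇒x≡y w

  ∉ᶜ-⟦⟧ : ∀ {l : Lit m} l' → l ≢ l' → l ∉ᶜ ⟦ l' ⟧
  ∉ᶜ-⟦⟧ l' l≢l' = mk∉ᶜ (l≢l' ∘ ∈ᶜ-⟦⟧⁻ l')

  ∈ᶜ-─⁻ : ∀ {l : Lit m} C l' → l ∈ᶜ (C ─ l') → l ∈ᶜ C × l ≢ l'
  ∈ᶜ-─⁻ {_ , true}  C (w , true)  l∈ with SP.x∈p∩q⁻ (pos C) _ l∈
  ... | l∈C , l∉⁅w⁆ = l∈C , lit-≢ᵛ (SP.x∉⁅y⁆⇒x≢y (SP.x∈∁p⇒x∉p l∉⁅w⁆))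
  ∈ᶜ-─⁻ {_ , true}  C (w , false) l∈ = l∈ , lit-≢ᵖ λ ()
  ∈ᶜ-─⁻ {_ , false} C (w , true)  l∈ = l∈ , lit-≢ᵖ λ ()
  ∈ᶜ-─⁻ {_ , false} C (w , false) l∈ with SP.x∈p∩q⁻ (neg C) _ l∈
  ... | l∈C , l∉⁅w⁆ = l∈C , lit-≢ᵛ (SP.x∉⁅y⁆⇒x≢y (SP.x∈∁p⇒x∉p l∉⁅w⁆))

  ∈ᶜ-─⁺ : ∀ {l : Lit m} {C} l' → l ∈ᶜ C → l ≢ l' → l ∈ᶜ (C ─ l')
  ∈ᶜ-─⁺ {_ , true}  (w , true)  l∈C l≢l' = SP.x∈p∩q⁺ (l∈C , SP.x∉p⇒x∈∁p (SP.x≢y⇒x∉⁅y⁆ (l≢l' ∘ cong (_, true))))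
  ∈ᶜ-─⁺ {_ , true}  (w , false) l∈C _    = l∈C
  ∈ᶜ-─⁺ {_ , false} (w , true)  l∈C _    = l∈C
  ∈ᶜ-─⁺ {_ , false} (w , false) l∈C l≢l' = SP.x∈p∩q⁺ (l∈C , SP.x∉p⇒x∈∁p (SP.x≢y⇒x∉⁅y⁆ (l≢l' ∘ cong (_, false))))

  clause-ext : ∀ {C C' : Clause m} → C ⊆ᶜ C' → C' ⊆ᶜ C → C ≡ C'
  clause-ext C⊆C' C'⊆C = cong₂ clause (SP.⊆-antisym (λ {v} → C⊆C' {v , true}) (λ {v} → C'⊆C {v , true}))
                                      (SP.⊆-antisym (λ {v} → C⊆C' {v , false}) (λ {v} → C'⊆C {v , false}))

  □-⊆ᶜ : ∀ {C : Clause m} → □ ⊆ᶜ C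
  □-⊆ᶜ = ⊥-elim ∘ ∉ᶜ-elim ∉ᶜ-□

  ∨-comm : ∀ (C C' : Clause m) → C ∨ C' ≡ C' ∨ C
  ∨-comm C C' = cong₂ clause (SP.∪-comm (pos C) (pos C')) (SP.∪-comm (neg C) (neg C'))

  ∨-absorbʳ : ∀ {C C' : Clause m} → C' ⊆ᶜ C → C ∨ C' ≡ C
  ∨-absorbʳ {C} {C'} C'⊆C = clause-ext ([ id , C'⊆C ]′ ∘ ∈ᶜ-∨⁻ C C') ∈ᶜ-∨⁺ˡ

  ⟦⟧∨-─ : ∀ {l : Lit m} {C} → l ∉ᶜ C → (⟦ l ⟧ ∨ C) ─ l ≡ C
  ⟦⟧∨-─ {l} {C} l∉C = clause-ext removed⊆C C⊆removed
    where
    removed⊆C : ((⟦ l ⟧ ∨ C) ─ l) ⊆ᶜ C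
    removed⊆C l'∈ with ∈ᶜ-─⁻ (⟦ l ⟧ ∨ C) l l'∈
    ... | l'∈⟦l⟧∨C , l'≢l = [ ⊥-elim ∘ l'≢l ∘ ∈ᶜ-⟦⟧⁻ l , id ]′ (∈ᶜ-∨⁻ ⟦ l ⟧ C l'∈⟦l⟧∨C)
    C⊆removed : C ⊆ᶜ ((⟦ l ⟧ ∨ C) ─ l)
    C⊆removed l'∈C = ∈ᶜ-─⁺ l (∈ᶜ-∨⁺ʳ l'∈C) λ { refl → ∉ᶜ-elim l∉C l'∈C }

  ¬taut-⟦⟧ : ∀ (l : Lit m) → ¬ Tautology ⟦ l ⟧
  ¬taut-⟦⟧ (v , true)  (_ , _ , v∈⊥) = SP.∉⊥ v∈⊥
  ¬taut-⟦⟧ (v , false) (_ , v∈⊥ , _) = SP.∉⊥ v∈⊥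

  ¬taut-⟦⟧∨ : ∀ (l : Lit m) {C} → ¬ Tautology C → neg-lit l ∉ᶜ C → ¬ Tautology (⟦ l ⟧ ∨ C)
  ¬taut-⟦⟧∨ l {C} ¬taut (mk∉ᶜ l̄∉C) (v , v∈pos , v∈neg)
    with ∈ᶜ-∨⁻ {v , true} ⟦ l ⟧ C v∈pos | ∈ᶜ-∨⁻ {v , false} ⟦ l ⟧ C v∈neg
  ... | inj₁ p | inj₁ q = lit-≢ᵖ (λ ()) (trans (∈ᶜ-⟦⟧⁻ {v , true} l p) (sym (∈ᶜ-⟦⟧⁻ {v , false} l q)))
  ... | inj₁ p | inj₂ q = l̄∉C (subst (λ l' → neg-lit l' ∈ᶜ C) (∈ᶜ-⟦⟧⁻ {v , true} l p) q)
  ... | inj₂ p | inj₁ q = l̄∉C (subst (λ l' → neg-lit l' ∈ᶜ C) (∈ᶜ-⟦⟧⁻ {v , false} l q) p)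
  ... | inj₂ p | inj₂ q = ¬taut (v , p , q)

  ∈ᶜ-head : ∀ {l : Lit m} {C D} → D ≡ ⟦ l ⟧ ∨ C → l ∈ᶜ D
  ∈ᶜ-head {l} refl = ∈ᶜ-∨⁺ˡ {l} (∈ᶜ-⟦⟧ l)

  resolve : ∀ {F : QBF m} {Γ D E C C'} (x : Fin m) → prefix F x ≡ ∃q →
            D ∈ˡ Γ → D ≡ ⟦ x , true ⟧ ∨ C → (x , true) ∉ᶜ C →
            E ∈ˡ Γ → E ≡ ⟦ x , false ⟧ ∨ C' → (x , false) ∉ᶜ C' →
            C' ⊆ᶜ C → ¬ Tautology C → ResStep F Γ C
  resolve {D = D} {E} {C} {C'} x x-∃ D∈Γ D≡ x∉C E∈Γ E≡ x̄∉C' C'⊆C ¬taut = record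
    { D = D ; E = E ; D∈Γ = D∈Γ ; E∈Γ = E∈Γ ; x = x ; x-∃ = x-∃
    ; x∈D = ∈ᶜ-head {x , true} D≡
    ; x̄∈E = ∈ᶜ-head {x , false} E≡
    ; result = sym resolvent≡C
    ; nonTaut = ¬taut }
    where
    open ≡-Reasoning
    resolvent≡C : (D ─ (x , true)) ∨ (E ─ (x , false)) ≡ C
    resolvent≡C = begin
      (D ─ (x , true)) ∨ (E ─ (x , false))
        ≡⟨ cong₂ (λ D E → (D ─ (x , true)) ∨ (E ─ (x , false))) D≡ E≡ ⟩
      ((⟦ x , true ⟧ ∨ C) ─ (x , true)) ∨ ((⟦ x , false ⟧ ∨ C') ─ (x , false))
        ≡⟨ cong₂ _∨_ (⟦⟧∨-─ {x , true} x∉C) (⟦⟧∨-─ {x , false} x̄∉C') ⟩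
      C ∨ C'
        ≡⟨ ∨-absorbʳ C'⊆C ⟩
      C ∎

  reduce-universal : ∀ {F : QBF m} {Γ D R} (l : Lit m) → prefix F (proj₁ l) ≡ ∀q →
                     D ∈ˡ Γ → D ≡ ⟦ l ⟧ ∨ R → l ∉ᶜ R → neg-lit l ∉ᶜ R →
                     (∀ {k} → k ∈ᶜ R → prefix F (proj₁ k) ≡ ∀q) → RedStep F Γ R
  reduce-universal {D = D} l l-∀ D∈Γ D≡ l∉R l̄∉R R-universal = record
    { D = D ; D∈Γ = D∈Γ ; l = l ; l-∀ = l-∀
    ; l∈D = ∈ᶜ-head {l} D≡
    ; result = sym (trans (cong (_─ l) D≡) (⟦⟧∨-─ {l} l∉R))
    ; l̄∉R = ∉ᶜ-elim l̄∉R
    ; ∃-before = λ k k∈R k-∃ → ⊥-elim (∀≢∃ (trans (sym (R-universal k∈R)) k-∃)) }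
    where
    ∀≢∃ : ∀q ≢ ∃q
    ∀≢∃ ()

module QUParityRefutation (k : ℕ) where

  n : ℕ
  n = 2 + k

  open QUParity n

  F : QBF m
  F = QUPARITY+ψ

  m≡1+n+n : m ≡ suc (n + n)
  m≡1+n+n = trans (+-comm (2 * n) 1) (cong (λ c → suc (n + c)) (+-identityʳ n))

  <m : ∀ {c} → c ≤ n + n → c < m
  <m {c} c≤n+n = subst (c <_) (sym m≡1+n+n) (s≤s c≤n+n)

  -- Reducing mod m only makes var total; it is applied to indices below m.
  var : ℕ → Fin m
  var c = c mod m

  toℕ-var : ∀ {c} → c < m → toℕ (var c) ≡ c
  toℕ-var {c} c<m = trans (toℕ-fromℕ< _) (m<n⇒m%n≡m c<m)

  xv yv : ℕ → Fin m
  xv i = var (i ∸ 1)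
  yv j = var (n + j)

  a₁ a₂ : Fin m
  a₁ = var n
  a₂ = var (suc n)

  toℕ-xv : ∀ {i} → i ≤ n → toℕ (xv i) ≡ i ∸ 1
  toℕ-xv i≤n = toℕ-var (<m (≤-trans (m∸n≤m _ 1) (≤-trans i≤n (m≤m+n n n))))

  toℕ-xv<n : ∀ {i} → i ≤ n → toℕ (xv i) < n
  toℕ-xv<n i≤n = subst (_< n) (sym (toℕ-xv i≤n)) (s≤s (∸-monoˡ-≤ 1 i≤n))

  1+n<toℕ-yv : ∀ {j} → 2 ≤ j → j ≤ n → suc n < toℕ (yv j)
  1+n<toℕ-yv {j} 2≤j j≤n =
    subst (suc n <_) (sym (toℕ-var (<m (+-monoʳ-≤ n j≤n)))) (subst (_≤ n + j) (+-comm n 2) (+-monoʳ-≤ n 2≤j))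

  toℕ-a₁ : toℕ a₁ ≡ n
  toℕ-a₁ = toℕ-var (<m (m≤m+n n n))

  toℕ-a₂ : toℕ a₂ ≡ suc n
  toℕ-a₂ = toℕ-var (<m (subst (_≤ n + n) (+-comm n 1) (+-monoʳ-≤ n (s≤s z≤n))))

  ≡ᵇ-true⇒≡ : ∀ {c c'} → (c ≡ᵇ c') ≡ true → c ≡ c'
  ≡ᵇ-true⇒≡ {c} {c'} e = ≡ᵇ⇒≡ c c' (Equivalence.from T-≡ e)

  prefixQ-∃ : ∀ v → toℕ v ≢ n → toℕ v ≢ suc n → prefixQ v ≡ ∃q
  prefixQ-∃ v ≢n ≢1+n with toℕ v ≡ᵇ n in e₁ | toℕ v ≡ᵇ suc n in e₂
  ... | false | false = refl
  ... | true  | _     = ⊥-elim (≢n (≡ᵇ-true⇒≡ e₁))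
  ... | false | true  = ⊥-elim (≢1+n (≡ᵇ-true⇒≡ e₂))

  prefixQ-∀ : ∀ v → toℕ v ≡ n ⊎ toℕ v ≡ suc n → prefixQ v ≡ ∀q
  prefixQ-∀ v is-a with toℕ v ≡ᵇ n in e₁ | toℕ v ≡ᵇ suc n in e₂
  ... | true  | _     = refl
  ... | false | true  = refl
  ... | false | false =
    ⊥-elim ([ subst T e₁ ∘ ≡⇒≡ᵇ (toℕ v) n , subst T e₂ ∘ ≡⇒≡ᵇ (toℕ v) (suc n) ]′ is-a)

  xv-∃ : ∀ {i} → i ≤ n → prefixQ (xv i) ≡ ∃q
  xv-∃ {i} i≤n = prefixQ-∃ (xv i) (<⇒≢ x<n) (<⇒≢ (m<n⇒m<1+n x<n))
    where
    x<n : toℕ (xv i) < n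
    x<n = toℕ-xv<n i≤n

  yv-∃ : ∀ {j} → 2 ≤ j → j ≤ n → prefixQ (yv j) ≡ ∃q
  yv-∃ {j} 2≤j j≤n = prefixQ-∃ (yv j) (>⇒≢ (<-trans (n<1+n n) 1+n<y)) (>⇒≢ 1+n<y)
    where
    1+n<y : suc n < toℕ (yv j)
    1+n<y = 1+n<toℕ-yv 2≤j j≤n

  a₁-∀ : prefixQ a₁ ≡ ∀q
  a₁-∀ = prefixQ-∀ a₁ (inj₁ toℕ-a₁)

  a₂-∀ : prefixQ a₂ ≡ ∀q
  a₂-∀ = prefixQ-∀ a₂ (inj₂ toℕ-a₂)

  ∃≢∀ : ∀ {v w} → prefixQ v ≡ ∃q → prefixQ w ≡ ∀q → v ≢ w
  ∃≢∀ v-∃ w-∀ refl with trans (sym v-∃) w-∀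
  ... | ()

  xv≢yv : ∀ {i j} → i ≤ n → 2 ≤ j → j ≤ n → xv i ≢ yv j
  xv≢yv i≤n 2≤j j≤n =
    <⇒≢ (<-trans (toℕ-xv<n i≤n) (<-trans (n<1+n n) (1+n<toℕ-yv 2≤j j≤n))) ∘ cong toℕ

  xv₁≢xv₂ : xv 1 ≢ xv 2
  xv₁≢xv₂ e = 0≢1+n (trans (sym (toℕ-xv (s≤s z≤n))) (trans (cong toℕ e) (toℕ-xv (s≤s (s≤s z≤n)))))

  a₂≢a₁ : a₂ ≢ a₁
  a₂≢a₁ e = <⇒≢ (n<1+n n) (trans (sym toℕ-a₁) (trans (cong toℕ (sym e)) toℕ-a₂))

  ≡ᵇ-indicator : ∀ {c} → c < m → tabulate (λ v → toℕ v ≡ᵇ c) ≡ S.⁅ var c ⁆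
  ≡ᵇ-indicator {c} c<m = SP.⊆-antisym indicator⊆ ⊆indicator
    where
    is-c : Fin m → Bool
    is-c v = toℕ v ≡ᵇ c
    ∈indicator⇒toℕ≡ : ∀ {v} → v S.∈ tabulate is-c → toℕ v ≡ c
    ∈indicator⇒toℕ≡ {v} v∈ = ≡ᵇ-true⇒≡ (trans (sym (lookup∘tabulate is-c v)) ([]=⇒lookup v∈))
    indicator⊆ : tabulate is-c S.⊆ S.⁅ var c ⁆
    indicator⊆ v∈ = subst (S._∈ S.⁅ var c ⁆) (toℕ-injective (trans (toℕ-var c<m) (sym (∈indicator⇒toℕ≡ v∈)))) (SP.x∈⁅x⁆ (var c))
    ⊆indicator : S.⁅ var c ⁆ S.⊆ tabulate is-c
    ⊆indicator {v} v∈ = lookup⇒[]= v (tabulate is-c) (trans (lookup∘tabulate is-c v) (Equivalence.to T-≡ (≡⇒≡ᵇ (toℕ v) c toℕ-v≡c)))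
      where
      toℕ-v≡c : toℕ v ≡ c
      toℕ-v≡c = trans (cong toℕ (SP.x∈⁅y⁆⇒x≡y _ v∈)) (toℕ-var c<m)

  lit≡⟦⟧ : ∀ {c} b → c < m → lit c b ≡ ⟦ var c , b ⟧
  lit≡⟦⟧ true  c<m = cong (λ p → clause p S.⊥) (≡ᵇ-indicator c<m)
  lit≡⟦⟧ false c<m = cong (clause S.⊥) (≡ᵇ-indicator c<m)

  x≡⟦⟧ : ∀ {i} b → i ≤ n → x i b ≡ ⟦ xv i , b ⟧
  x≡⟦⟧ b i≤n = lit≡⟦⟧ b (<m (≤-trans (m∸n≤m _ 1) (≤-trans i≤n (m≤m+n n n))))

  y≡⟦⟧ : ∀ {j} b → j ≤ n → y j b ≡ ⟦ yv j , b ⟧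
  y≡⟦⟧ b j≤n = lit≡⟦⟧ b (<m (+-monoʳ-≤ n j≤n))

  aa⁺ : Clause m
  aa⁺ = ⟦ a₁ , true ⟧ ∨ ⟦ a₂ , true ⟧

  Ȳ XȲ : ℕ → Clause m
  Ȳ j = ⟦ yv j , false ⟧ ∨ aa⁺
  XȲ j = ⟦ xv j , true ⟧ ∨ Ȳ j

  aa≡aa⁺ : aa ≡ aa⁺
  aa≡aa⁺ = cong₂ _∨_ (a≡⟦⟧ (cong suc (+-comm k 1)) (m≤m+n n n))
                     (a≡⟦⟧ (cong suc (+-comm k 2)) (subst (_≤ n + n) (+-comm n 1) (+-monoʳ-≤ n (s≤s z≤n))))
    where
    a≡⟦⟧ : ∀ {c c'} → c ≡ c' → c' ≤ n + n → lit c true ≡ ⟦ var c' , true ⟧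
    a≡⟦⟧ refl c≤n+n = lit≡⟦⟧ true (<m c≤n+n)

  XȲ≡ : ∀ {j} → j ≤ n → x j true ∨ y j false ∨ aa ≡ XȲ j
  XȲ≡ j≤n = cong₂ _∨_ (x≡⟦⟧ true j≤n) (cong₂ _∨_ (y≡⟦⟧ false j≤n) aa≡aa⁺)

  D : ℕ → Clause m
  D j = prev j true ∨ x j true ∨ y j false ∨ aa

  Q E₁ : Clause m
  Q = x 1 false ∨ x 2 true
  E₁ = aa ∨ y n true

  D₂≡ : D 2 ≡ ⟦ xv 1 , true ⟧ ∨ XȲ 2
  D₂≡ = cong₂ _∨_ (x≡⟦⟧ true (s≤s z≤n)) (XȲ≡ (s≤s (s≤s z≤n)))

  D≡ : ∀ {i} → 3 + i ≤ n → D (3 + i) ≡ ⟦ yv (2 + i) , true ⟧ ∨ XȲ (3 + i)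
  D≡ 3+i≤n = cong₂ _∨_ (y≡⟦⟧ true (<⇒≤ 3+i≤n)) (XȲ≡ 3+i≤n)

  Q≡ : Q ≡ ⟦ xv 1 , false ⟧ ∨ ⟦ xv 2 , true ⟧
  Q≡ = cong₂ _∨_ (x≡⟦⟧ false (s≤s z≤n)) (x≡⟦⟧ true (s≤s (s≤s z≤n)))

  x̄≡ : ∀ {j} → j ≤ n → x j false ≡ ⟦ xv j , false ⟧ ∨ □
  x̄≡ j≤n = trans (x≡⟦⟧ false j≤n) (sym (∨-absorbʳ □-⊆ᶜ))

  E₁≡ : E₁ ≡ ⟦ yv n , true ⟧ ∨ aa⁺
  E₁≡ = trans (∨-comm aa (y n true)) (cong₂ _∨_ (y≡⟦⟧ true ≤-refl) aa≡aa⁺)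

  ∈js : ∀ {i} → i ≤ k → 2 + i ∈ˡ js
  ∈js {i} i≤k = subst (_∈ˡ js) (+-comm i 2) (∈-map⁺ (_+ 2) (∈-upTo⁺ (s≤s i≤k)))

  ∈concatMap' : ∀ (f : ℕ → List (Clause m)) {j js' C} → j ∈ˡ js' → C ∈ˡ f j → C ∈ˡ concatMap' f js'
  ∈concatMap' f {js' = j ∷ _}   (here refl) C∈ = ∈-++⁺ˡ C∈
  ∈concatMap' f {js' = j' ∷ _} (there j∈)  C∈ = ∈-++⁺ʳ (f j') (∈concatMap' f j∈ C∈)

  D∈ : ∀ {i} → i ≤ k → D (2 + i) ∈ˡ matrix F
  D∈ i≤k = ∈-++⁺ˡ (∈-++⁺ˡ (∈concatMap' (block aa) (∈js i≤k) (there (there (there (here refl))))))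

  E₁∈ : E₁ ∈ˡ matrix F
  E₁∈ = ∈-++⁺ˡ (∈-++⁺ʳ (concatMap' (block aa) js) (here refl))

  Q∈ : Q ∈ˡ matrix F
  Q∈ = ∈-++⁺ʳ φ (here refl)

  x̄∈ : ∀ {i} → i ≤ k → x (2 + i) false ∈ˡ matrix F
  x̄∈ i≤k = ∈-++⁺ʳ φ (there (∈-map⁺ (λ j → x j false) (∈js i≤k)))

  ∃-∉aa⁺ : ∀ {v b} → prefixQ v ≡ ∃q → (v , b) ∉ᶜ aa⁺
  ∃-∉aa⁺ v-∃ = ∉ᶜ-∨ (∉ᶜ-⟦⟧ (a₁ , true) (lit-≢ᵛ (∃≢∀ v-∃ a₁-∀))) (∉ᶜ-⟦⟧ (a₂ , true) (lit-≢ᵛ (∃≢∀ v-∃ a₂-∀)))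

  ∉Ȳ : ∀ j {v b} → prefixQ v ≡ ∃q → (v , b) ≢ (yv j , false) → (v , b) ∉ᶜ Ȳ j
  ∉Ȳ j v-∃ ≢ȳ = ∉ᶜ-∨ (∉ᶜ-⟦⟧ (yv j , false) ≢ȳ) (∃-∉aa⁺ v-∃)

  ∉XȲ : ∀ j {v b} → prefixQ v ≡ ∃q → (v , b) ≢ (xv j , true) → (v , b) ≢ (yv j , false) → (v , b) ∉ᶜ XȲ j
  ∉XȲ j v-∃ ≢x ≢ȳ = ∉ᶜ-∨ (∉ᶜ-⟦⟧ (xv j , true) ≢x) (∉Ȳ j v-∃ ≢ȳ)

  ¬taut-aa⁺ : ¬ Tautology aa⁺
  ¬taut-aa⁺ = ¬taut-⟦⟧∨ (a₁ , true) (¬taut-⟦⟧ (a₂ , true)) (∉ᶜ-⟦⟧ (a₂ , true) (lit-≢ᵖ λ ()))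

  ¬taut-Ȳ : ∀ {j} → 2 ≤ j → j ≤ n → ¬ Tautology (Ȳ j)
  ¬taut-Ȳ {j} 2≤j j≤n = ¬taut-⟦⟧∨ (yv j , false) ¬taut-aa⁺ (∃-∉aa⁺ (yv-∃ 2≤j j≤n))

  ¬taut-XȲ : ∀ {j} → 2 ≤ j → j ≤ n → ¬ Tautology (XȲ j)
  ¬taut-XȲ {j} 2≤j j≤n =
    ¬taut-⟦⟧∨ (xv j , true) (¬taut-Ȳ 2≤j j≤n) (∉Ȳ j (xv-∃ j≤n) (lit-≢ᵛ (xv≢yv j≤n 2≤j j≤n)))

  resolve-x₁ : ResStep F (D 2 ∷ Q ∷ []) (XȲ 2)
  resolve-x₁ = resolve (xv 1) (xv-∃ 1≤n)
    (here refl) D₂≡ (∉XȲ 2 (xv-∃ 1≤n) (lit-≢ᵛ xv₁≢xv₂) (lit-≢ᵖ λ ()))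
    (there (here refl)) Q≡ (∉ᶜ-⟦⟧ (xv 2 , true) (lit-≢ᵖ λ ()))
    ∈ᶜ-∨⁺ˡ (¬taut-XȲ ≤-refl 2≤n)
    where
    1≤n : 1 ≤ n
    1≤n = s≤s z≤n
    2≤n : 2 ≤ n
    2≤n = s≤s (s≤s z≤n)

  resolve-x : ∀ {Γ j} → 2 ≤ j → j ≤ n → ResStep F (x j false ∷ XȲ j ∷ Γ) (Ȳ j)
  resolve-x {j = j} 2≤j j≤n = resolve (xv j) (xv-∃ j≤n)
    (there (here refl)) refl (∉Ȳ j (xv-∃ j≤n) (lit-≢ᵖ λ ()))
    (here refl) (x̄≡ j≤n) ∉ᶜ-□
    □-⊆ᶜ (¬taut-Ȳ 2≤j j≤n)

  resolve-y : ∀ {Γ i} → 3 + i ≤ n → ResStep F (D (3 + i) ∷ Ȳ (2 + i) ∷ Γ) (XȲ (3 + i))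
  resolve-y {i = i} 3+i≤n = resolve (yv (2 + i)) y-∃
    (here refl) (D≡ 3+i≤n) (∉XȲ (3 + i) y-∃ (lit-≢ᵛ (xv≢yv 3+i≤n (s≤s (s≤s z≤n)) (<⇒≤ 3+i≤n) ∘ sym)) (lit-≢ᵖ λ ()))
    (there (here refl)) refl (∃-∉aa⁺ y-∃)
    (∈ᶜ-∨⁺ʳ ∘ ∈ᶜ-∨⁺ʳ) (¬taut-XȲ (s≤s (s≤s z≤n)) 3+i≤n)
    where
    y-∃ : prefixQ (yv (2 + i)) ≡ ∃q
    y-∃ = yv-∃ (s≤s (s≤s z≤n)) (<⇒≤ 3+i≤n)

  resolve-yₙ : ∀ {Γ} → ResStep F (E₁ ∷ Ȳ n ∷ Γ) aa⁺
  resolve-yₙ = resolve (yv n) yₙ-∃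
    (here refl) E₁≡ (∃-∉aa⁺ yₙ-∃)
    (there (here refl)) refl (∃-∉aa⁺ yₙ-∃)
    id ¬taut-aa⁺
    where
    yₙ-∃ : prefixQ (yv n) ≡ ∃q
    yₙ-∃ = yv-∃ (s≤s (s≤s z≤n)) ≤-refl

  reduce-a₂ : ∀ {Γ} → RedStep F (aa⁺ ∷ Γ) ⟦ a₁ , true ⟧
  reduce-a₂ = reduce-universal (a₂ , true) a₂-∀
    (here refl) (∨-comm ⟦ a₁ , true ⟧ ⟦ a₂ , true ⟧)
    (∉ᶜ-⟦⟧ (a₁ , true) (lit-≢ᵛ a₂≢a₁)) (∉ᶜ-⟦⟧ (a₁ , true) (lit-≢ᵖ λ ()))
    λ {l} l∈ → subst (λ l' → prefixQ (proj₁ l') ≡ ∀q) (sym (∈ᶜ-⟦⟧⁻ {l = l} (a₁ , true) l∈)) a₁-∀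

  reduce-a₁ : ∀ {Γ} → RedStep F (⟦ a₁ , true ⟧ ∷ Γ) □
  reduce-a₁ = reduce-universal (a₁ , true) a₁-∀
    (here refl) (sym (∨-absorbʳ □-⊆ᶜ)) ∉ᶜ-□ ∉ᶜ-□ (λ {l} → ⊥-elim ∘ ∉ᶜ-elim (∉ᶜ-□ {l = l}))

  Ȳ-derivation : ∀ i → i ≤ k → ∃ λ Γ → Derivation F (Ȳ (2 + i) ∷ Γ) (2 * suc i)
  Ȳ-derivation zero _ =
    _ , res (ax (res (ax (ax [] Q∈) (D∈ z≤n)) resolve-x₁) (x̄∈ z≤n)) (resolve-x ≤-refl (s≤s (s≤s z≤n)))
  Ȳ-derivation (suc i) i<k with Ȳ-derivation i (<⇒≤ i<k)
  ... | Γ , d = _ , subst (Derivation F _) (sym (*-suc 2 (suc i)))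
    (res (ax (res (ax d (D∈ i<k)) (resolve-y 3+i≤n)) (x̄∈ i<k)) (resolve-x (s≤s (s≤s z≤n)) 3+i≤n))
    where
    3+i≤n : 3 + i ≤ n
    3+i≤n = s≤s (s≤s i<k)

  refutation : Refutation F (3 + 2 * suc k)
  refutation with Ȳ-derivation k ≤-refl
  ... | Γ , d = _ , red (red (res (ax d E₁∈) resolve-yₙ) reduce-a₂) reduce-a₁

step-count : ∀ k → 3 + 2 * suc k ≡ 2 * (2 + k) + 1
step-count = solve-∀

mainTheorem2 : ∀ (n : ℕ) → 1 < n →
    ∃ λ k → Refutation (QUParity.QUPARITY+ψ n) k × k ≤ 2 * n + 1
mainTheorem2 (suc zero) (s≤s ())
mainTheorem2 (suc (suc k)) _ = _ , QUParityRefutation.refutation k , ≤-reflexive (step-count k)
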